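{- Let $\phi=(1+\sqrt5)/2$ and for $k\ge1$ let $A'(k,3)=\sum_{n=1}^{F_k-1}\lfloor\phi^2 n\rfloor^3$. Then for every integer $k\ge1$, $$A'(2k,3)=\frac14(F_{2k}-1)(F_{2k+2}-1)\cdot\frac15\bigl(L_{4k+4}-5L_{2k+3}+13\bigr)$$ and $$A'(2k-1,3)=\frac14(F_{2k-1}-1)(F_{2k+1}-1)\cdot\frac15\bigl(L_{4k+2}-5L_{2k+2}+7\bigr).$$
   Context: $\lfloor x\rfloor$ denotes the integer part of $x$; an empty sum is $0$. The Fibonacci numbers $F_n$ and Lucas numbers $L_n$ are defined by $F_0=0$, $F_1=1$, $L_0=2$, $L_1=1$ and $F_{n+2}=F_{n+1}+F_n$, $L_{n+2}=L_{n+1}+L_n$ for $n\ge0$. -}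

module Defs where

open import Data.Nat using (ℕ; zero; suc; _+_; _*_; _∸_; _^_; _≤_; _<_)
open import Data.Product using (_×_)

F : ℕ → ℕ
F 0 = 0
F 1 = 1
F (suc (suc n)) = F (suc n) + F n

L : ℕ → ℕ
L 0 = 2
L 1 = 1
L (suc (suc n)) = L (suc n) + L n

-- φ² = (3 + √5)/2.  For naturals a, b:
--   a ≤ φ² b  ⇔  2a − 3b ≤ √5 b  ⇔  (2a ∸ 3b)² ≤ 5 b²
_≤φ²·_ : ℕ → ℕ → Set
a ≤φ²· b = (2 * a ∸ 3 * b) ^ 2 ≤ 5 * b ^ 2

--   φ² b < c  ⇔  √5 b < 2c − 3b  ⇔  3b < 2c and 5 b² < (2c − 3b)²
φ²·_<_ : ℕ → ℕ → Set
φ²· b < c = (3 * b < 2 * c) × (5 * b ^ 2 < (2 * c ∸ 3 * b) ^ 2)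

IsFloorφ² : ℕ → ℕ → Set
IsFloorφ² n m = (m ≤φ²· n) × (φ²· n < suc m)

sum1 : (ℕ → ℕ) → ℕ → ℕ
sum1 g zero = 0
sum1 g (suc m) = sum1 g m + g (suc m)

A' : (ℕ → ℕ) → ℕ → ℕ
A' fl k = sum1 (λ n → fl n ^ 3) (F k ∸ 1)

{-# OPTIONS --safe #-}
-- With x = 2m − 3n, m = ⌊φ² n⌋ says x ≤ √5 n < x + 2, since 2φ² = 3 + √5. Because
-- L_K² − 5 F_K² = 4 (−1)^K, the fractions L_K / F_K approximate √5 alternately from either side;
-- this gives ⌊φ² F_K⌋ = F_{K+2} − [K even] and, adding approximations (x² and 5n² are congruent
-- mod 4 and, √5 being irrational, distinct, so there is room), ⌊φ² (F_K + n)⌋ = F_{K+2} + ⌊φ² n⌋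
-- for 0 < n < F_K. So the range 1 … F_{k+3} − 1 splits into 1 … F_{k+2} − 1, the point F_{k+2},
-- and a copy of 1 … F_{k+1} − 1 whose floors are all raised by F_{k+4}. Summing (t + ⌊φ² n⌋)³
-- over these ranges, with a free shift t to absorb the raise, gives a three-term recursion in k
-- that an explicit polynomial P(t, F_k, F_{k+1}) satisfies as a ring identity, once the floor at
-- F_{k+2} is written through the Cassini sign F_{k+2}² − F_{k+2} F_{k+1} − F_{k+1}² = ±1.
-- At t = 0 the polynomial factors into the stated closed form.
module Submission where

open import Defs
open import Data.Nat using (ℕ; _≤_)
open import Data.Product using (_×_)
open import Relation.Binary.PropositionalEquality using (_≡_)

module Brackets where
  open import Data.Nat
  open import Data.Nat.Properties
  open import Data.Nat.Divisibility using (_∣_; divides)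
  open import Data.Nat.Primality using (prime?; euclidsLemma)
  open import Data.Nat.Induction using (<-rec)
  open import Data.Nat.Tactic.RingSolver using (solve)
  open import Data.List using (_∷_; [])
  open import Data.Product using (_,_)
  open import Data.Sum using ([_,_]′)
  open import Function using (id; _∘_)
  open import Relation.Nullary using (contradiction)
  open import Relation.Nullary.Decidable using (from-yes)
  open import Relation.Binary.PropositionalEquality

  square-cancel-≤ : ∀ {x y} → x * x ≤ y * y → x ≤ y
  square-cancel-≤ x²≤y² = ≮⇒≥ λ y<x → <⇒≱ (*-mono-< y<x y<x) x²≤y²

  square-cancel-< : ∀ {x y} → x * x < y * y → x < y
  square-cancel-< x²<y² = ≰⇒> λ y≤x → <⇒≱ x²<y² (*-mono-≤ y≤x y≤x)

  5∣square⇒5∣ : ∀ {x} → 5 ∣ x * x → 5 ∣ x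
  5∣square⇒5∣ {x} = [ id , id ]′ ∘ euclidsLemma x x (from-yes (prime? 5))

  √5-irrational : ∀ n x → x * x ≡ 5 * (n * n) → n ≡ 0
  √5-irrational = <-rec _ descent
    where
    5-descent : ∀ a b → (a * 5) * (a * 5) ≡ 5 * b → b ≡ a * a * 5
    5-descent a b e = *-cancelˡ-≡ b (a * a * 5) 5 (trans (sym e) (solve (a ∷ [])))
    descent : ∀ n → (∀ {m} → m < n → ∀ y → y * y ≡ 5 * (m * m) → m ≡ 0) →
              ∀ x → x * x ≡ 5 * (n * n) → n ≡ 0
    descent n smaller x x²≡5n²
      with 5∣square⇒5∣ {x} (divides (n * n) (trans x²≡5n² (*-comm 5 (n * n))))
    ... | divides y refl with 5∣square⇒5∣ {n} (divides (y * y) (5-descent y (n * n) x²≡5n²))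
    ... | divides zero refl = refl
    ... | divides z@(suc _) refl =
      cong (_* 5) (smaller (m<m*n z 5 (s≤s (s≤s z≤n))) y
        (trans (5-descent z (y * y) (trans (5-descent y _ x²≡5n²) (*-comm (y * y) 5))) (*-comm (z * z) 5)))

  ≡[4]∧<⇒+4≤ : ∀ {a b p q} → a + 4 * p ≡ 4 * q + b → a < b → a + 4 ≤ b
  ≡[4]∧<⇒+4≤ {a} {b} {p} {q} e a<b = +-cancelˡ-≤ (4 * q) (a + 4) b (begin
    4 * q + (a + 4) ≡⟨ solve (a ∷ q ∷ []) ⟩
    a + 4 * (1 + q) ≤⟨ +-monoʳ-≤ a (*-monoʳ-≤ 4 q<p) ⟩
    a + 4 * p       ≡⟨ e ⟩
    4 * q + b       ∎)
    where
    open ≤-Reasoning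
    q<p : q < p
    q<p = *-cancelˡ-< 4 q p (+-cancelʳ-< a (4 * q) (4 * p) (begin-strict
      4 * q + a <⟨ +-monoʳ-< (4 * q) a<b ⟩
      4 * q + b ≡⟨ sym e ⟩
      a + 4 * p ≡⟨ +-comm a (4 * p) ⟩
      4 * p + a ∎))

  -- m = ⌊φ² n⌋ with x = 2m − 3n, as 2 φ² n = 3n + √5 n.
  record Bracket (n m x : ℕ) : Set where
    field
      offset : x + 3 * n ≡ 2 * m
      lower  : x * x ≤ 5 * (n * n)
      upper  : 5 * (n * n) < (2 + x) * (2 + x)

  x^2≡x*x : ∀ x → x ^ 2 ≡ x * x
  x^2≡x*x x = cong (x *_) (^-identityʳ x)

  floor⇒bracket : ∀ {n m} → IsFloorφ² n m → Bracket n m (2 * m ∸ 3 * n)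
  floor⇒bracket {n} {m} (below , _ , above) = record
    { offset = m∸n+n≡m 3n≤2m
    ; lower  = subst₂ _≤_ (x^2≡x*x (2 * m ∸ 3 * n)) (cong (5 *_) (x^2≡x*x n)) below
    ; upper  = subst₂ _<_ (cong (5 *_) (x^2≡x*x n))
                 (trans (cong (_^ 2) 2[m+1]∸3n) (x^2≡x*x (2 + (2 * m ∸ 3 * n)))) above
    }
    where
    open ≤-Reasoning
    too-small : ∀ {n m} → 2 * m < 3 * n → (2 * suc m ∸ 3 * n) ^ 2 ≤ 5 * n ^ 2
    too-small {zero} ()
    too-small {n@(suc _)} {m} 2m<3n = ≤-trans (^-monoˡ-≤ 2 (m≤n+o⇒m∸n≤o (2 * suc m) (3 * n) (begin
      2 * suc m   ≡⟨ *-suc 2 m ⟩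
      2 + 2 * m   ≤⟨ s≤s 2m<3n ⟩
      suc (3 * n) ≡⟨ +-comm 1 (3 * n) ⟩
      3 * n + 1   ∎))) (s≤s z≤n)
    3n≤2m : 3 * n ≤ 2 * m
    3n≤2m = ≮⇒≥ λ 2m<3n → <⇒≱ above (too-small {n} {m} 2m<3n)
    2[m+1]∸3n : 2 * suc m ∸ 3 * n ≡ 2 + (2 * m ∸ 3 * n)
    2[m+1]∸3n = trans (cong (_∸ 3 * n) (*-suc 2 m)) (+-∸-assoc 2 3n≤2m)

  bracket-unique : ∀ {n m m′ x x′} → Bracket n m x → Bracket n m′ x′ → m ≡ m′
  bracket-unique b b′ = ≤-antisym (≤-from b b′) (≤-from b′ b)
    where
    ≤-from : ∀ {n m m′ x x′} → Bracket n m x → Bracket n m′ x′ → m ≤ m′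
    ≤-from {n} {m} {m′} {x} {x′} b b′ = s≤s⁻¹ (*-cancelˡ-< 2 m (suc m′) (begin-strict
      2 * m          ≡⟨ sym (Bracket.offset b) ⟩
      x + 3 * n      <⟨ +-monoˡ-< (3 * n) x<2+x′ ⟩
      2 + x′ + 3 * n ≡⟨ cong (2 +_) (Bracket.offset b′) ⟩
      2 + 2 * m′     ≡⟨ sym (*-suc 2 m′) ⟩
      2 * suc m′     ∎))
      where
      open ≤-Reasoning
      x<2+x′ : x < 2 + x′
      x<2+x′ = square-cancel-< (≤-<-trans (Bracket.lower b) (Bracket.upper b′))

  offset⇒≡[4] : ∀ n m x → x + 3 * n ≡ 2 * m → x * x + 4 * (3 * (m * n)) ≡ 4 * (m * m + n * n) + 5 * (n * n)
  offset⇒≡[4] n m x e = begin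
    x * x + 4 * (3 * (m * n))               ≡⟨ solve (x ∷ n ∷ m ∷ []) ⟩
    x * x + 6 * n * (2 * m)                 ≡⟨ cong (λ s → x * x + 6 * n * s) (sym e) ⟩
    x * x + 6 * n * (x + 3 * n)             ≡⟨ solve (x ∷ n ∷ []) ⟩
    (x + 3 * n) * (x + 3 * n) + 9 * (n * n) ≡⟨ cong (λ s → s * s + 9 * (n * n)) e ⟩
    (2 * m) * (2 * m) + 9 * (n * n)         ≡⟨ solve (n ∷ m ∷ []) ⟩
    4 * (m * m + n * n) + 5 * (n * n)       ∎
    where open ≡-Reasoning

  -- x ≡ n (mod 2) makes x² ≡ 5n² (mod 4), so once they differ they are at least 4 apart.
  module _ {n m x} (b : Bracket n m x) where
    open Bracket b

    lower-gap : 1 ≤ n → x * x + 4 ≤ 5 * (n * n)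
    lower-gap 1≤n = ≡[4]∧<⇒+4≤ {p = 3 * (m * n)} {q = m * m + n * n} (offset⇒≡[4] n m x offset)
      (≤∧≢⇒< lower λ e → <⇒≢ 1≤n (sym (√5-irrational n x e)))

    upper-gap : 5 * (n * n) + 4 ≤ (2 + x) * (2 + x)
    upper-gap = ≡[4]∧<⇒+4≤ {p = suc m * suc m + n * n} {q = 3 * (suc m * n)} swapped upper
      where
      e : (2 + x) * (2 + x) + 4 * (3 * (suc m * n)) ≡ 4 * (suc m * suc m + n * n) + 5 * (n * n)
      e = offset⇒≡[4] n (suc m) (2 + x) (trans (cong (2 +_) offset) (sym (*-suc 2 m)))
      swapped : 5 * (n * n) + 4 * (suc m * suc m + n * n) ≡ 4 * (3 * (suc m * n)) + (2 + x) * (2 + x)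
      swapped = trans (+-comm (5 * (n * n)) _) (trans (sym e) (+-comm ((2 + x) * (2 + x)) _))

  cross-≤ : ∀ x y n m → x * x ≤ 5 * (n * n) → y * y ≤ 5 * (m * m) → x * y ≤ 5 * n * m
  cross-≤ x y n m x²≤5n² y²≤5m² = square-cancel-≤ (begin
    x * y * (x * y)               ≡⟨ solve (x ∷ y ∷ []) ⟩
    x * x * (y * y)               ≤⟨ *-mono-≤ x²≤5n² y²≤5m² ⟩
    5 * (n * n) * (5 * (m * m))   ≡⟨ solve (n ∷ m ∷ []) ⟩
    5 * n * m * (5 * n * m)       ∎)
    where open ≤-Reasoning

  cross-< : ∀ x y n m → 5 * (n * n) < x * x → 5 * (m * m) < y * y → 5 * n * m < x * y
  cross-< x y n m 5n²<x² 5m²<y² = square-cancel-< (begin-strict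
    5 * n * m * (5 * n * m)       ≡⟨ solve (n ∷ m ∷ []) ⟩
    5 * (n * n) * (5 * (m * m))   <⟨ *-mono-< 5n²<x² 5m²<y² ⟩
    x * x * (y * y)               ≡⟨ solve (x ∷ y ∷ []) ⟩
    x * y * (x * y)               ∎)
    where open ≤-Reasoning

  pell⁺-cross-≤ : ∀ L f n x → L * L ≡ 5 * (f * f) + 4 → n ≤ f → x * x + 4 ≤ 5 * (n * n) →
                  L * x ≤ 5 * f * n
  pell⁺-cross-≤ L f n x e n≤f gap = square-cancel-≤ (+-cancelʳ-≤ (20 * (n * n)) _ _ (begin
    L * x * (L * x) + 20 * (n * n)         ≤⟨ +-monoʳ-≤ (L * x * (L * x)) 20n²≤4L² ⟩
    L * x * (L * x) + 4 * (L * L)          ≡⟨ solve (L ∷ x ∷ []) ⟩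
    L * L * (x * x + 4)                    ≤⟨ *-monoʳ-≤ (L * L) gap ⟩
    L * L * (5 * (n * n))                  ≡⟨ cong (_* (5 * (n * n))) e ⟩
    (5 * (f * f) + 4) * (5 * (n * n))      ≡⟨ solve (f ∷ n ∷ []) ⟩
    5 * f * n * (5 * f * n) + 20 * (n * n) ∎))
    where
    open ≤-Reasoning
    20n²≤4L² : 20 * (n * n) ≤ 4 * (L * L)
    20n²≤4L² = begin
      20 * (n * n)          ≤⟨ *-monoʳ-≤ 20 (*-mono-≤ n≤f n≤f) ⟩
      20 * (f * f)          ≤⟨ m≤m+n (20 * (f * f)) 16 ⟩
      20 * (f * f) + 16     ≡⟨ solve (f ∷ []) ⟩
      4 * (5 * (f * f) + 4) ≡⟨ cong (4 *_) (sym e) ⟩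
      4 * (L * L)           ∎

  pell⁻-cross-< : ∀ L f n y → L * L + 4 ≡ 5 * (f * f) → n < f → 5 * (n * n) + 4 ≤ y * y →
                  5 * f * n < L * y
  pell⁻-cross-< L f n y e n<f gap = square-cancel-< (begin-strict
    5 * f * n * (5 * f * n)                   ≡⟨ solve (f ∷ n ∷ []) ⟩
    5 * (f * f) * (5 * (n * n))               ≡⟨ cong (_* (5 * (n * n))) (sym e) ⟩
    (L * L + 4) * (5 * (n * n))               ≡⟨ solve (L ∷ n ∷ []) ⟩
    L * L * (5 * (n * n)) + 4 * (5 * (n * n)) <⟨ +-monoʳ-< (L * L * (5 * (n * n))) (*-monoʳ-< 4 5n²<L²) ⟩
    L * L * (5 * (n * n)) + 4 * (L * L)       ≡⟨ solve (L ∷ n ∷ []) ⟩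
    L * L * (5 * (n * n) + 4)                 ≤⟨ *-monoʳ-≤ (L * L) gap ⟩
    L * L * (y * y)                           ≡⟨ solve (L ∷ y ∷ []) ⟩
    L * y * (L * y)                           ∎)
    where
    open ≤-Reasoning
    5n²<L² : 5 * (n * n) < L * L
    5n²<L² = +-cancelʳ-≤ 4 _ _ (begin
      1 + 5 * (n * n) + 4          ≡⟨ solve (n ∷ []) ⟩
      5 * (n * n) + 5              ≤⟨ m≤m+n (5 * (n * n) + 5) (10 * n) ⟩
      5 * (n * n) + 5 + 10 * n     ≡⟨ solve (n ∷ []) ⟩
      5 * ((1 + n) * (1 + n))      ≤⟨ *-monoʳ-≤ 5 (*-mono-≤ n<f n<f) ⟩
      5 * (f * f)                  ≡⟨ sym e ⟩
      L * L + 4                    ∎)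

  +-below-√5 : ∀ x y n m → x * x + y * y ≤ 5 * (n * n) + 5 * (m * m) → x * y ≤ 5 * n * m →
               (x + y) * (x + y) ≤ 5 * ((n + m) * (n + m))
  +-below-√5 x y n m squares cross = begin
    (x + y) * (x + y)                         ≡⟨ solve (x ∷ y ∷ []) ⟩
    x * x + y * y + 2 * (x * y)               ≤⟨ +-mono-≤ squares (*-monoʳ-≤ 2 cross) ⟩
    5 * (n * n) + 5 * (m * m) + 2 * (5 * n * m) ≡⟨ solve (n ∷ m ∷ []) ⟩
    5 * ((n + m) * (n + m))                   ∎
    where open ≤-Reasoning

  +-above-√5 : ∀ x y n m → 5 * (n * n) + 5 * (m * m) ≤ x * x + y * y → 5 * n * m < x * y →
               5 * ((n + m) * (n + m)) < (x + y) * (x + y)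
  +-above-√5 x y n m squares cross = begin-strict
    5 * ((n + m) * (n + m))                   ≡⟨ solve (n ∷ m ∷ []) ⟩
    5 * (n * n) + 5 * (m * m) + 2 * (5 * n * m) <⟨ +-mono-≤-< squares (*-monoʳ-< 2 cross) ⟩
    x * x + y * y + 2 * (x * y)               ≡⟨ solve (x ∷ y ∷ []) ⟩
    (x + y) * (x + y)                         ∎
    where open ≤-Reasoning

  bracket-+ : ∀ f c L n m x → L + 3 * f ≡ 2 * c → x + 3 * n ≡ 2 * m →
              (L + x) * (L + x) ≤ 5 * ((f + n) * (f + n)) →
              5 * ((f + n) * (f + n)) < (L + (2 + x)) * (L + (2 + x)) →
              Bracket (f + n) (c + m) (L + x)
  bracket-+ f c L n m x eL ex below above = record
    { offset = begin
        L + x + 3 * (f + n)       ≡⟨ solve (f ∷ L ∷ n ∷ x ∷ []) ⟩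
        (L + 3 * f) + (x + 3 * n) ≡⟨ cong₂ _+_ eL ex ⟩
        2 * c + 2 * m             ≡⟨ sym (*-distribˡ-+ 2 c m) ⟩
        2 * (c + m)               ∎
    ; lower  = below
    ; upper  = subst (λ s → 5 * ((f + n) * (f + n)) < s * s) shuffle above
    }
    where
    open ≡-Reasoning
    shuffle : L + (2 + x) ≡ 2 + (L + x)
    shuffle = solve (L ∷ x ∷ [])

  -- Adding (L, f) with L² = 5f² ± 4 to the bracket (x, n) of some n < f keeps a bracket: where
  -- L/f overshoots √5, the gap of x/n on the other side of √5 makes up for it.
  module _ L f c {n m x} (eL : L + 3 * f ≡ 2 * c) (b : Bracket n m x) where
    open Bracket b

    bracket-shift⁺ : L * L ≡ 5 * (f * f) + 4 → 1 ≤ n → n ≤ f → Bracket (f + n) (c + m) (L + x)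
    bracket-shift⁺ pell 1≤n n≤f = bracket-+ f c L n m x eL offset
      (+-below-√5 L x f n (begin
        L * L + x * x             ≡⟨ cong (_+ x * x) pell ⟩
        5 * (f * f) + 4 + x * x   ≡⟨ solve (f ∷ x ∷ []) ⟩
        5 * (f * f) + (x * x + 4) ≤⟨ +-monoʳ-≤ (5 * (f * f)) (lower-gap b 1≤n) ⟩
        5 * (f * f) + 5 * (n * n) ∎) (pell⁺-cross-≤ L f n x pell n≤f (lower-gap b 1≤n)))
      (+-above-√5 L (2 + x) f n (+-mono-≤ (<⇒≤ 5f²<L²) (<⇒≤ upper)) (cross-< L (2 + x) f n 5f²<L² upper))
      where
      open ≤-Reasoning
      5f²<L² : 5 * (f * f) < L * L
      5f²<L² = subst (5 * (f * f) <_) (sym pell) (m<m+n (5 * (f * f)) z<s)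

    bracket-shift⁻ : L * L + 4 ≡ 5 * (f * f) → n < f → Bracket (f + n) (c + m) (L + x)
    bracket-shift⁻ pell n<f = bracket-+ f c L n m x eL offset
      (+-below-√5 L x f n (+-mono-≤ L²≤5f² lower) (cross-≤ L x f n L²≤5f² lower))
      (+-above-√5 L (2 + x) f n (begin
        5 * (f * f) + 5 * (n * n)   ≡⟨ cong (_+ 5 * (n * n)) (sym pell) ⟩
        L * L + 4 + 5 * (n * n)     ≡⟨ solve (L ∷ n ∷ []) ⟩
        L * L + (5 * (n * n) + 4)   ≤⟨ +-monoʳ-≤ (L * L) (upper-gap b) ⟩
        L * L + (2 + x) * (2 + x)   ∎) (pell⁻-cross-< L f n (2 + x) pell n<f (upper-gap b)))
      where
      open ≤-Reasoning
      L²≤5f² : L * L ≤ 5 * (f * f)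
      L²≤5f² = subst (L * L ≤_) pell (m≤m+n (L * L) 4)

  bracket-pell⁺ : ∀ L f {m} → L * L ≡ 5 * (f * f) + 4 → L + 3 * f ≡ 2 * suc m → Bracket f m (L ∸ 2)
  bracket-pell⁺ zero f pell = contradiction (trans pell (+-comm (5 * (f * f)) 4)) λ ()
  bracket-pell⁺ 1 f pell = contradiction (trans pell (+-comm (5 * (f * f)) 4)) λ ()
  bracket-pell⁺ (suc (suc l)) f {m} pell e = record
    { offset = +-cancelˡ-≡ 2 (l + 3 * f) (2 * m) (trans e (*-suc 2 m))
    ; lower  = +-cancelʳ-≤ 4 (l * l) (5 * (f * f)) (begin
        l * l + 4         ≤⟨ +-monoˡ-≤ 4 (m≤m+n (l * l) (4 * l)) ⟩
        l * l + 4 * l + 4 ≡⟨ solve (l ∷ []) ⟩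
        (2 + l) * (2 + l) ≡⟨ pell ⟩
        5 * (f * f) + 4   ∎)
    ; upper  = subst (5 * (f * f) <_) (sym pell) (m<m+n (5 * (f * f)) z<s)
    }
    where open ≤-Reasoning

  bracket-pell⁻ : ∀ L f {m} → L * L + 4 ≡ 5 * (f * f) → 1 ≤ L → L + 3 * f ≡ 2 * m → Bracket f m L
  bracket-pell⁻ L f {m} pell 1≤L e = record
    { offset = e
    ; lower  = subst (L * L ≤_) pell (m≤m+n (L * L) 4)
    ; upper  = begin-strict
        5 * (f * f)        ≡⟨ sym pell ⟩
        L * L + 4          <⟨ m<m+n (L * L + 4) (≤-trans (s≤s z≤n) (*-monoʳ-≤ 4 1≤L)) ⟩
        L * L + 4 + 4 * L  ≡⟨ solve (L ∷ []) ⟩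
        (2 + L) * (2 + L)  ∎
    }
    where open ≤-Reasoning

module Fibonacci where
  open import Data.Nat
  open import Data.Nat.Properties
  open import Data.Nat.Tactic.RingSolver using (solve; solve-∀)
  open import Data.List using (_∷_; [])
  open import Data.Sum using (_⊎_; inj₁; inj₂; [_,_]′)
  open import Function using (_∘_)
  open import Relation.Binary.PropositionalEquality
  open ≡-Reasoning
  open import Algebra.Properties.CommutativeSemigroup +-commutativeSemigroup using (interchange)

  -- Cassini's identity F (K+1)² − F (K+1) F K − F K² = (−1)ᴷ, split by sign to stay in ℕ.
  CassiniEven CassiniOdd : ℕ → Set
  CassiniEven K = F (suc K) * F (suc K) ≡ F (suc K) * F K + F K * F K + 1
  CassiniOdd  K = F (suc K) * F (suc K) + 1 ≡ F (suc K) * F K + F K * F K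

  cassini⁺-step : ∀ a b → b * b ≡ b * a + a * a + 1 → (b + a) * (b + a) + 1 ≡ (b + a) * b + b * b
  cassini⁺-step a b e = begin
    (b + a) * (b + a) + 1               ≡⟨ solve (a ∷ b ∷ []) ⟩
    b * b + b * a + (b * a + a * a + 1) ≡⟨ cong (b * b + b * a +_) (sym e) ⟩
    b * b + b * a + b * b               ≡⟨ solve (a ∷ b ∷ []) ⟩
    (b + a) * b + b * b                 ∎

  cassini⁻-step : ∀ a b → b * b + 1 ≡ b * a + a * a → (b + a) * (b + a) ≡ (b + a) * b + b * b + 1
  cassini⁻-step a b o = begin
    (b + a) * (b + a)               ≡⟨ solve (a ∷ b ∷ []) ⟩
    b * b + b * a + (b * a + a * a) ≡⟨ cong (b * b + b * a +_) (sym o) ⟩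
    b * b + b * a + (b * b + 1)     ≡⟨ solve (a ∷ b ∷ []) ⟩
    (b + a) * b + b * b + 1         ∎

  cassini-even⇒odd : ∀ K → CassiniEven K → CassiniOdd (suc K)
  cassini-even⇒odd K = cassini⁺-step (F K) (F (suc K))

  cassini-odd⇒even : ∀ K → CassiniOdd K → CassiniEven (suc K)
  cassini-odd⇒even K = cassini⁻-step (F K) (F (suc K))

  cassini : ∀ K → CassiniEven K ⊎ CassiniOdd K
  cassini zero    = inj₁ refl
  cassini (suc K) = [ inj₂ ∘ cassini-even⇒odd K , inj₁ ∘ cassini-odd⇒even K ]′ (cassini K)

  cassini-even : ∀ j → CassiniEven (2 * j)
  cassini-odd  : ∀ j → CassiniOdd (suc (2 * j))
  cassini-even zero    = refl
  cassini-even (suc j) = subst CassiniEven (sym (*-suc 2 j)) (cassini-odd⇒even (suc (2 * j)) (cassini-odd j))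
  cassini-odd j = cassini-even⇒odd (2 * j) (cassini-even j)

  F-pos : ∀ K → 1 ≤ F (suc K)
  F-pos zero    = ≤-refl
  F-pos (suc K) = ≤-trans (F-pos K) (m≤m+n (F (suc K)) (F K))

  L-pos : ∀ K → 1 ≤ L K
  L-pos zero          = s≤s z≤n
  L-pos (suc zero)    = ≤-refl
  L-pos (suc (suc K)) = ≤-trans (L-pos (suc K)) (m≤m+n (L (suc K)) (L K))

  L+F≡2F : ∀ K → L K + F K ≡ 2 * F (suc K)
  L+F≡2F zero          = refl
  L+F≡2F (suc zero)    = refl
  L+F≡2F (suc (suc K)) = begin
    (L (suc K) + L K) + (F (suc K) + F K) ≡⟨ interchange (L (suc K)) (L K) (F (suc K)) (F K) ⟩
    (L (suc K) + F (suc K)) + (L K + F K) ≡⟨ cong₂ _+_ (L+F≡2F (suc K)) (L+F≡2F K) ⟩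
    2 * F (suc (suc K)) + 2 * F (suc K)   ≡⟨ sym (*-distribˡ-+ 2 (F (suc (suc K))) (F (suc K))) ⟩
    2 * (F (suc (suc K)) + F (suc K))     ∎

  L+3F≡2F : ∀ K → L K + 3 * F K ≡ 2 * F (2 + K)
  L+3F≡2F K = shift (L K) (F K) (F (suc K)) (L+F≡2F K)
    where
    shift : ∀ ℓ a b → ℓ + a ≡ 2 * b → ℓ + 3 * a ≡ 2 * (b + a)
    shift ℓ a b e = begin
      ℓ + 3 * a         ≡⟨ solve (ℓ ∷ a ∷ []) ⟩
      (ℓ + a) + 2 * a   ≡⟨ cong (_+ 2 * a) e ⟩
      2 * b + 2 * a     ≡⟨ sym (*-distribˡ-+ 2 b a) ⟩
      2 * (b + a)       ∎

  ℓ+a≡2b⇒ℓ²+4ab≡4b²+a² : ∀ ℓ a b → ℓ + a ≡ 2 * b → ℓ * ℓ + 4 * (a * b) ≡ 4 * (b * b) + a * a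
  ℓ+a≡2b⇒ℓ²+4ab≡4b²+a² ℓ a b e = begin
    ℓ * ℓ + 4 * (a * b)       ≡⟨ solve (ℓ ∷ a ∷ b ∷ []) ⟩
    ℓ * ℓ + 2 * a * (2 * b)   ≡⟨ cong (λ s → ℓ * ℓ + 2 * a * s) (sym e) ⟩
    ℓ * ℓ + 2 * a * (ℓ + a)   ≡⟨ solve (ℓ ∷ a ∷ []) ⟩
    (ℓ + a) * (ℓ + a) + a * a ≡⟨ cong (λ s → s * s + a * a) e ⟩
    (2 * b) * (2 * b) + a * a ≡⟨ solve (a ∷ b ∷ []) ⟩
    4 * (b * b) + a * a       ∎

  lucas²-even : ∀ K → CassiniEven K → L K * L K ≡ 5 * (F K * F K) + 4
  lucas²-even K c = +-cancelʳ-≡ (4 * (a * b)) _ _ (begin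
    L K * L K + 4 * (a * b)         ≡⟨ ℓ+a≡2b⇒ℓ²+4ab≡4b²+a² (L K) a b (L+F≡2F K) ⟩
    4 * (b * b) + a * a             ≡⟨ cong (λ s → 4 * s + a * a) c ⟩
    4 * (b * a + a * a + 1) + a * a ≡⟨ regroup a b ⟩
    5 * (a * a) + 4 + 4 * (a * b)   ∎)
    where
    a = F K
    b = F (suc K)
    regroup : ∀ a b → 4 * (b * a + a * a + 1) + a * a ≡ 5 * (a * a) + 4 + 4 * (a * b)
    regroup = solve-∀

  lucas²-odd : ∀ K → CassiniOdd K → L K * L K + 4 ≡ 5 * (F K * F K)
  lucas²-odd K c = +-cancelʳ-≡ (4 * (a * b)) _ _ (begin
    L K * L K + 4 + 4 * (a * b) ≡⟨ swap-4 (L K * L K) (4 * (a * b)) ⟩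
    L K * L K + 4 * (a * b) + 4 ≡⟨ cong (_+ 4) (ℓ+a≡2b⇒ℓ²+4ab≡4b²+a² (L K) a b (L+F≡2F K)) ⟩
    4 * (b * b) + a * a + 4     ≡⟨ regroup₁ a b ⟩
    4 * (b * b + 1) + a * a     ≡⟨ cong (λ s → 4 * s + a * a) c ⟩
    4 * (b * a + a * a) + a * a ≡⟨ regroup₂ a b ⟩
    5 * (a * a) + 4 * (a * b)   ∎)
    where
    a = F K
    b = F (suc K)
    swap-4 : ∀ x y → x + 4 + y ≡ x + y + 4
    swap-4 = solve-∀
    regroup₁ : ∀ a b → 4 * (b * b) + a * a + 4 ≡ 4 * (b * b + 1) + a * a
    regroup₁ = solve-∀
    regroup₂ : ∀ a b → 4 * (b * a + a * a) + a * a ≡ 5 * (a * a) + 4 * (a * b)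
    regroup₂ = solve-∀

  L-suc : ∀ n → L (suc n) ≡ F n + F (2 + n)
  L-suc zero          = refl
  L-suc (suc zero)    = refl
  L-suc (suc (suc n)) = trans (cong₂ _+_ (L-suc (suc n)) (L-suc n))
    (interchange (F (suc n)) (F (3 + n)) (F n) (F (2 + n)))

  F-+ : ∀ m n → F (suc (m + n)) ≡ F (suc m) * F (suc n) + F m * F n
  F-+ zero          n = sym (trans (+-identityʳ _) (*-identityˡ _))
  F-+ (suc zero)    n = sym (cong₂ _+_ (*-identityˡ (F (suc n))) (*-identityˡ (F n)))
  F-+ (suc (suc m)) n = trans (cong₂ _+_ (F-+ (suc m) n) (F-+ m n))
    (regroup (F (2 + m)) (F (suc m)) (F m) (F (suc n)) (F n))
    where
    regroup : ∀ p q r x y → (p * x + q * y) + (q * x + r * y) ≡ (p + q) * x + (q + r) * y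
    regroup = solve-∀

  L-3+N : ∀ N → L (3 + N) ≡ 3 * F N + 4 * F (suc N)
  L-3+N N = trans (L-suc (2 + N)) (collect (F N) (F (suc N)))
    where
    collect : ∀ a b → (b + a) + (((b + a) + b) + (b + a)) ≡ 3 * a + 4 * b
    collect = solve-∀

  L-4+N+N : ∀ N → L (4 + (N + N)) ≡ 3 * (F N * F N) + 8 * (F N * F (suc N)) + 7 * (F (suc N) * F (suc N))
  L-4+N+N N = begin
    L (4 + (N + N))                               ≡⟨ L-suc (3 + (N + N)) ⟩
    F (3 + (N + N)) + F (5 + (N + N))             ≡⟨ cong₂ _+_ (cong F i₁) (cong F i₂) ⟩
    F (suc (suc N + suc N)) + F (suc (2 + N + (2 + N))) ≡⟨ cong₂ _+_ (F-+ (suc N) (suc N)) (F-+ (2 + N) (2 + N)) ⟩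
    _                                             ≡⟨ collect (F N) (F (suc N)) ⟩
    3 * (F N * F N) + 8 * (F N * F (suc N)) + 7 * (F (suc N) * F (suc N)) ∎
    where
    i₁ : 3 + (N + N) ≡ suc (suc N + suc N)
    i₁ = cong (2 +_) (sym (+-suc N N))
    i₂ : 5 + (N + N) ≡ suc (2 + N + (2 + N))
    i₂ = cong (3 +_) (sym (trans (+-suc N (suc N)) (cong suc (+-suc N N))))
    collect : ∀ a b → (b + a) * (b + a) + b * b + (((b + a) + b) * ((b + a) + b) + (b + a) * (b + a))
                      ≡ 3 * (a * a) + 8 * (a * b) + 7 * (b * b)
    collect = solve-∀

module Sums where
  open import Data.Nat
  open import Data.Nat.Properties
  open import Relation.Binary.PropositionalEquality

  sum1-split : ∀ g a b → sum1 g (a + b) ≡ sum1 g a + sum1 (λ n → g (a + n)) b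
  sum1-split g a zero    = trans (cong (sum1 g) (+-identityʳ a)) (sym (+-identityʳ (sum1 g a)))
  sum1-split g a (suc b) rewrite +-suc a b =
    trans (cong (_+ g (suc (a + b))) (sum1-split g a b)) (+-assoc (sum1 g a) _ _)

  sum1-split-at : ∀ g {a b} → 1 ≤ a → 1 ≤ b →
                  sum1 g (a + b ∸ 1) ≡ sum1 g (a ∸ 1) + g a + sum1 (λ n → g (a + n)) (b ∸ 1)
  sum1-split-at g {suc a} {suc b} _ _ = trans (cong (sum1 g) (+-suc a b)) (sum1-split g (suc a) b)

  sum1-cong : ∀ {g h} m → (∀ n → 1 ≤ n → n ≤ m → g n ≡ h n) → sum1 g m ≡ sum1 h m
  sum1-cong zero    _   = refl
  sum1-cong (suc m) g≗h =
    cong₂ _+_ (sum1-cong m λ n 1≤n n≤m → g≗h n 1≤n (m≤n⇒m≤1+n n≤m)) (g≗h (suc m) (s≤s z≤n) ≤-refl)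

module Polynomials where
  import Data.Nat as Nat
  import Data.Nat.Properties as NatP
  open import Data.Integer
  open import Data.Integer.Properties using (pos-+; pos-*; *-assoc; *-zeroˡ)
  open import Data.Integer.Tactic.RingSolver using (solve-∀)
  open import Relation.Binary.PropositionalEquality
  open Fibonacci using (CassiniEven; CassiniOdd)

  cassiniForm : ℤ → ℤ → ℤ
  cassiniForm a b = b * b - b * a - a * a

  -- 4 (w − δ)³ with δ = (1 − D)/2, for D ∈ {1, −1}
  floorCube : ℤ → ℤ → ℤ
  floorCube w D = + 4 * (w * w * w) + + 2 * (D - + 1) * (w * w * w - (w - + 1) * (w - + 1) * (w - + 1))

  cubeMeanPoly : ℤ → ℤ → ℤ → ℤ
  cubeMeanPoly t a b =
      + 4 * (t * t * t) + + 6 * (a + b - + 1) * (t * t)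
    + + 2 * (a * a + + 3 * (a * b) + + 3 * (b * b) - + 5 * a - + 6 * b + + 3) * t
    + (a * a * b + + 3 * (a * b * b) + + 2 * (b * b * b) - + 3 * (a * a) - + 8 * (a * b)
       - + 6 * (b * b) + + 5 * a + + 6 * b - + 2)

  -- 4 Σ_{n=1}^{a−1} (t + ⌊φ² n⌋)³ when (a , b) = (F k , F (k + 1)), k ≥ 1
  cubeSumPoly : ℤ → ℤ → ℤ → ℤ
  cubeSumPoly t a b = (a - + 1) * cubeMeanPoly t a b

  cubeSumPoly-step : ∀ t u v → let w = t + ((v + u) + v) in
    cubeSumPoly t (v + u) ((v + u) + v)
      ≡ cubeSumPoly t v (v + u) + floorCube w (cassiniForm u v) + cubeSumPoly w u v
  cubeSumPoly-step = ring-identity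
    where
    -- the ring solver does not unfold definitions, so the polynomials are spelled out
    ring-identity : ∀ t u v →
      let P = λ t a b → (a - + 1) *
                ( + 4 * (t * t * t) + + 6 * (a + b - + 1) * (t * t)
                + + 2 * (a * a + + 3 * (a * b) + + 3 * (b * b) - + 5 * a - + 6 * b + + 3) * t
                + (a * a * b + + 3 * (a * b * b) + + 2 * (b * b * b) - + 3 * (a * a) - + 8 * (a * b)
                   - + 6 * (b * b) + + 5 * a + + 6 * b - + 2))
          w = t + ((v + u) + v)
      in P t (v + u) ((v + u) + v)
           ≡ P t v (v + u)
             + (+ 4 * (w * w * w) + + 2 * ((v * v - v * u - u * u) - + 1) * (w * w * w - (w - + 1) * (w - + 1) * (w - + 1)))
             + P w u v
    ring-identity = solve-∀

  cubeSumPoly-at-0 : ∀ a b → + 5 * cubeSumPoly (+ 0) a b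
    ≡ (a - + 1) * (b + a - + 1)
      * (+ 3 * (a * a) + + 8 * (a * b) + + 7 * (b * b) - + 5 * (+ 3 * a + + 4 * b) + (+ 10 + + 3 * cassiniForm a b))
  cubeSumPoly-at-0 = ring-identity
    where
    ring-identity : ∀ a b →
      let P = λ t a b → (a - + 1) *
                ( + 4 * (t * t * t) + + 6 * (a + b - + 1) * (t * t)
                + + 2 * (a * a + + 3 * (a * b) + + 3 * (b * b) - + 5 * a - + 6 * b + + 3) * t
                + (a * a * b + + 3 * (a * b * b) + + 2 * (b * b * b) - + 3 * (a * a) - + 8 * (a * b)
                   - + 6 * (b * b) + + 5 * a + + 6 * b - + 2))
      in + 5 * P (+ 0) a b
           ≡ (a - + 1) * (b + a - + 1)
             * (+ 3 * (a * a) + + 8 * (a * b) + + 7 * (b * b) - + 5 * (+ 3 * a + + 4 * b)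
                + (+ 10 + + 3 * (b * b - b * a - a * a)))
    ring-identity = solve-∀

  pos-ba+aa : ∀ a b → + (b Nat.* a Nat.+ a Nat.* a) ≡ + b * + a + + a * + a
  pos-ba+aa a b = trans (pos-+ (b Nat.* a) (a Nat.* a)) (cong₂ _+_ (pos-* b a) (pos-* a a))

  cassiniForm-even : ∀ K → CassiniEven K → cassiniForm (+ F K) (+ F (Nat.suc K)) ≡ + 1
  cassiniForm-even K e = begin
    + b * + b - + b * + a - + a * + a                       ≡⟨ cong (λ s → s - + b * + a - + a * + a) b² ⟩
    + b * + a + + a * + a + + 1 - + b * + a - + a * + a     ≡⟨ cancel (+ b * + a) (+ a * + a) ⟩
    + 1                                                     ∎
    where
    open ≡-Reasoning
    a = F K
    b = F (Nat.suc K)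
    b² : + b * + b ≡ + b * + a + + a * + a + + 1
    b² = trans (sym (pos-* b b)) (trans (cong +_ e) (trans (pos-+ _ 1) (cong (_+ + 1) (pos-ba+aa a b))))
    cancel : ∀ x y → x + y + + 1 - x - y ≡ + 1
    cancel = solve-∀

  cassiniForm-odd : ∀ K → CassiniOdd K → cassiniForm (+ F K) (+ F (Nat.suc K)) ≡ - + 1
  cassiniForm-odd K o = begin
    + b * + b - + b * + a - + a * + a                       ≡⟨ shift (+ b * + b) (+ b * + a) (+ a * + a) ⟩
    + b * + b + + 1 - + b * + a - + a * + a - + 1           ≡⟨ cong (λ s → s - + b * + a - + a * + a - + 1) b²+1 ⟩
    + b * + a + + a * + a - + b * + a - + a * + a - + 1     ≡⟨ cancel (+ b * + a) (+ a * + a) ⟩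
    - + 1                                                   ∎
    where
    open ≡-Reasoning
    a = F K
    b = F (Nat.suc K)
    b²+1 : + b * + b + + 1 ≡ + b * + a + + a * + a
    b²+1 = trans (sym (trans (pos-+ (b Nat.* b) 1) (cong (_+ + 1) (pos-* b b)))) (trans (cong +_ o) (pos-ba+aa a b))
    shift : ∀ s x y → s - x - y ≡ s + + 1 - x - y - + 1
    shift = solve-∀
    cancel : ∀ x y → x + y - x - y - + 1 ≡ - + 1
    cancel = solve-∀

  pos-cube : ∀ x → + (x Nat.^ 3) ≡ + x * + x * + x
  pos-cube x = begin
    + (x Nat.* (x Nat.* (x Nat.* 1))) ≡⟨ cong +_ (cong (x Nat.*_) (cong (x Nat.*_) (NatP.*-identityʳ x))) ⟩
    + (x Nat.* (x Nat.* x))           ≡⟨ pos-* x (x Nat.* x) ⟩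
    + x * + (x Nat.* x)               ≡⟨ cong (+ x *_) (pos-* x x) ⟩
    + x * (+ x * + x)                 ≡⟨ sym (*-assoc (+ x) (+ x) (+ x)) ⟩
    + x * + x * + x                   ∎
    where open ≡-Reasoning

  pos-cube-+ : ∀ x y → + ((x Nat.+ y) Nat.^ 3) ≡ (+ x + + y) * (+ x + + y) * (+ x + + y)
  pos-cube-+ x y = trans (pos-cube (x Nat.+ y)) (cong (λ s → s * s * s) (pos-+ x y))

  cubeSumPoly-at-1 : ∀ t b → cubeSumPoly t (+ 1) b ≡ + 0
  cubeSumPoly-at-1 t b = *-zeroˡ (cubeMeanPoly t (+ 1) b)

module Floor (fl : ℕ → ℕ) (hfl : ∀ n → IsFloorφ² n (fl n)) where
  open Brackets
  open Fibonacci
  open Sums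
  open Polynomials

  module FloorValues where
    open import Data.Nat
    open import Data.Nat.Properties
    open import Data.Sum using (_⊎_; inj₁; inj₂)
    open import Relation.Binary.PropositionalEquality

    fl-unique : ∀ {n m x} → Bracket n m x → fl n ≡ m
    fl-unique {n} = bracket-unique (floor⇒bracket (hfl n))

    fl-F-odd : ∀ K → CassiniOdd K → fl (F K) ≡ F (2 + K)
    fl-F-odd K c = fl-unique (bracket-pell⁻ (L K) (F K) (lucas²-odd K c) (L-pos K) (L+3F≡2F K))

    fl-F-even : ∀ K → CassiniEven K → suc (fl (F K)) ≡ F (2 + K)
    fl-F-even K c = trans (cong suc (fl-unique (bracket-pell⁺ (L K) (F K) (lucas²-even K c) e))) (suc-pred (F (2 + K)))
      where
      instance
        F[2+K]≢0 : NonZero (F (2 + K))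
        F[2+K]≢0 = >-nonZero (F-pos (suc K))
      e : L K + 3 * F K ≡ 2 * suc (pred (F (2 + K)))
      e = trans (L+3F≡2F K) (cong (2 *_) (sym (suc-pred (F (2 + K)))))

    fl-shift : ∀ K n → 1 ≤ n → n < F K → fl (F K + n) ≡ F (2 + K) + fl n
    fl-shift K n 1≤n n<F = fl-unique (shifted (cassini K))
      where
      shifted : CassiniEven K ⊎ CassiniOdd K → Bracket (F K + n) (F (2 + K) + fl n) (L K + (2 * fl n ∸ 3 * n))
      shifted (inj₁ c) = bracket-shift⁺ (L K) (F K) (F (2 + K)) (L+3F≡2F K) (floor⇒bracket (hfl n))
                           (lucas²-even K c) 1≤n (<⇒≤ n<F)
      shifted (inj₂ c) = bracket-shift⁻ (L K) (F K) (F (2 + K)) (L+3F≡2F K) (floor⇒bracket (hfl n))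
                           (lucas²-odd K c) n<F

    cubeSum : ℕ → ℕ → ℕ
    cubeSum t K = sum1 (λ n → (t + fl n) ^ 3) (F K ∸ 1)

    cubeSum-step : ∀ t k → cubeSum t (3 + k) ≡ cubeSum t (2 + k) + (t + fl (F (2 + k))) ^ 3 + cubeSum (t + F (4 + k)) (suc k)
    cubeSum-step t k = trans (sum1-split-at g (F-pos (suc k)) (F-pos k))
      (cong (cubeSum t (2 + k) + g (F (2 + k)) +_) (sum1-cong (F (suc k) ∸ 1) shifted))
      where
      g : ℕ → ℕ
      g n = (t + fl n) ^ 3
      instance
        F[1+k]≢0 : NonZero (F (suc k))
        F[1+k]≢0 = >-nonZero (F-pos k)
      shifted : ∀ n → 1 ≤ n → n ≤ F (suc k) ∸ 1 → g (F (2 + k) + n) ≡ (t + F (4 + k) + fl n) ^ 3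
      shifted n 1≤n n≤ = cong (_^ 3) (trans (cong (t +_) (fl-shift (2 + k) n 1≤n n<F)) (sym (+-assoc t _ (fl n))))
        where
        n<F : n < F (2 + k)
        n<F = ≤-trans (subst (suc n ≤_) (suc-pred (F (suc k))) (s≤s n≤)) (m≤m+n (F (suc k)) (F k))

  module CubeSums where
    import Data.Nat as Nat
    import Data.Nat.Properties as NatP
    import Data.Nat.Tactic.RingSolver as NatSolver
    open Nat using (zero; suc; _∸_)
    open import Data.Integer hiding (suc)
    open import Data.Integer.Properties using (pos-+; pos-*)
    open import Data.Integer.Tactic.RingSolver using (solve-∀)
    open import Data.Sum using (inj₁; inj₂)
    open import Relation.Binary.PropositionalEquality
    open FloorValues

    fl-F-cube : ∀ K t → + 4 * + ((t Nat.+ fl (F (suc K))) Nat.^ 3)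
                        ≡ floorCube (+ t + + F (3 Nat.+ K)) (cassiniForm (+ F K) (+ F (suc K)))
    fl-F-cube K t with cassini K
    ... | inj₁ c = begin
      + 4 * + ((t Nat.+ fl (F (suc K))) Nat.^ 3)
        ≡⟨ cong (λ f → + 4 * + ((t Nat.+ f) Nat.^ 3)) (fl-F-odd (suc K) (cassini-even⇒odd K c)) ⟩
      + 4 * + ((t Nat.+ F (3 Nat.+ K)) Nat.^ 3)       ≡⟨ cong (+ 4 *_) (pos-cube-+ t (F (3 Nat.+ K))) ⟩
      + 4 * (w * w * w)                               ≡⟨ exact w ⟩
      floorCube w (+ 1)                               ≡⟨ cong (floorCube w) (sym (cassiniForm-even K c)) ⟩
      floorCube w (cassiniForm (+ F K) (+ F (suc K))) ∎
      where
      open ≡-Reasoning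
      w = + t + + F (3 Nat.+ K)
      exact : ∀ w → + 4 * (w * w * w)
                    ≡ + 4 * (w * w * w) + + 2 * (+ 1 - + 1) * (w * w * w - (w - + 1) * (w - + 1) * (w - + 1))
      exact = solve-∀
    ... | inj₂ c = begin
      + 4 * + ((t Nat.+ f) Nat.^ 3)                   ≡⟨ cong (+ 4 *_) (pos-cube-+ t f) ⟩
      + 4 * ((+ t + + f) * (+ t + + f) * (+ t + + f)) ≡⟨ cong (λ s → + 4 * (s * s * s)) t+f≡w-1 ⟩
      + 4 * ((w - + 1) * (w - + 1) * (w - + 1))       ≡⟨ lowered w ⟩
      floorCube w (- + 1)                             ≡⟨ cong (floorCube w) (sym (cassiniForm-odd K c)) ⟩
      floorCube w (cassiniForm (+ F K) (+ F (suc K))) ∎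
      where
      open ≡-Reasoning
      f = fl (F (suc K))
      w = + t + + F (3 Nat.+ K)
      t+f≡w-1 : + t + + f ≡ w - + 1
      t+f≡w-1 = trans (sym (drop (+ t) (+ f))) (cong (λ s → + t + s - + 1)
                  (trans (sym (pos-+ f 1)) (cong +_ (trans (NatP.+-comm f 1) (fl-F-even (suc K) (cassini-odd⇒even K c))))))
        where
        drop : ∀ x y → x + (y + + 1) - + 1 ≡ x + y
        drop = solve-∀
      lowered : ∀ w → + 4 * ((w - + 1) * (w - + 1) * (w - + 1))
                      ≡ + 4 * (w * w * w) + + 2 * (- + 1 - + 1) * (w * w * w - (w - + 1) * (w - + 1) * (w - + 1))
      lowered = solve-∀

    cubeSum-closed : ∀ k t → + 4 * + cubeSum t (suc k) ≡ cubeSumPoly (+ t) (+ F (suc k)) (+ F (2 Nat.+ k))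
    cubeSum-closed zero          t = sym (cubeSumPoly-at-1 (+ t) (+ 1))
    cubeSum-closed (suc zero)    t = sym (cubeSumPoly-at-1 (+ t) (+ 2))
    cubeSum-closed (suc (suc k)) t = begin
      + 4 * + cubeSum t (3 Nat.+ k)                 ≡⟨ cong (λ s → + 4 * + s) (cubeSum-step t k) ⟩
      + 4 * + (S₂ Nat.+ C Nat.+ S₁)                 ≡⟨ distrib-4 S₂ C S₁ ⟩
      + 4 * + S₂ + + 4 * + C + + 4 * + S₁
        ≡⟨ cong₂ _+_ (cong₂ _+_ (cubeSum-closed (suc k) t) (fl-F-cube (suc k) t))
                     (trans (cubeSum-closed k (t Nat.+ F (4 Nat.+ k))) (cong (λ s → cubeSumPoly s u v) (pos-+ t (F (4 Nat.+ k))))) ⟩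
      cubeSumPoly (+ t) v (+ F (3 Nat.+ k)) + floorCube (+ t + + F (4 Nat.+ k)) D + cubeSumPoly (+ t + + F (4 Nat.+ k)) u v
        ≡⟨ cong₂ (λ b c → cubeSumPoly (+ t) v b + floorCube (+ t + c) D + cubeSumPoly (+ t + c) u v) F₃ F₄ ⟩
      cubeSumPoly (+ t) v (v + u) + floorCube (+ t + ((v + u) + v)) D + cubeSumPoly (+ t + ((v + u) + v)) u v
        ≡⟨ sym (cubeSumPoly-step (+ t) u v) ⟩
      cubeSumPoly (+ t) (v + u) ((v + u) + v)       ≡⟨ sym (cong₂ (cubeSumPoly (+ t)) F₃ F₄) ⟩
      cubeSumPoly (+ t) (+ F (3 Nat.+ k)) (+ F (4 Nat.+ k)) ∎
      where
      open ≡-Reasoning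
      S₂ = cubeSum t (2 Nat.+ k)
      C  = (t Nat.+ fl (F (2 Nat.+ k))) Nat.^ 3
      S₁ = cubeSum (t Nat.+ F (4 Nat.+ k)) (suc k)
      u  = + F (suc k)
      v  = + F (2 Nat.+ k)
      D  = cassiniForm u v
      F₃ : + F (3 Nat.+ k) ≡ v + u
      F₃ = pos-+ (F (2 Nat.+ k)) (F (suc k))
      F₄ : + F (4 Nat.+ k) ≡ (v + u) + v
      F₄ = trans (pos-+ (F (3 Nat.+ k)) (F (2 Nat.+ k))) (cong (_+ v) F₃)
      distrib-4 : ∀ x y z → + 4 * + (x Nat.+ y Nat.+ z) ≡ + 4 * + x + + 4 * + y + + 4 * + z
      distrib-4 x y z = trans (cong (+ 4 *_) (trans (pos-+ (x Nat.+ y) z) (cong (_+ + z) (pos-+ x y))))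
                              (distrib (+ x) (+ y) (+ z))
        where
        distrib : ∀ a b c → + 4 * (a + b + c) ≡ + 4 * a + + 4 * b + + 4 * c
        distrib = solve-∀

    closedForm : Nat.ℕ → Nat.ℕ → Nat.ℕ → Nat.ℕ → ℤ → ℤ
    closedForm N M P Q c = (+ F N - + 1) * (+ F M - + 1) * (+ L P - + 5 * + L Q + c)

    closedForm-cong : ∀ {N M M′ P P′ Q Q′ c c′} → M ≡ M′ → P ≡ P′ → Q ≡ Q′ → c ≡ c′ →
                      closedForm N M P Q c ≡ closedForm N M′ P′ Q′ c′
    closedForm-cong refl refl refl refl = refl

    A′-closedForm : ∀ N → + 20 * + A' fl N
      ≡ closedForm N (2 Nat.+ N) (4 Nat.+ (N Nat.+ N)) (3 Nat.+ N) (+ 10 + + 3 * cassiniForm (+ F N) (+ F (suc N)))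
    A′-closedForm zero      = refl
    A′-closedForm N@(suc k) = begin
      + 20 * + A' fl N                              ≡⟨ twenty (+ A' fl N) ⟩
      + 5 * (+ 4 * + cubeSum 0 N)                   ≡⟨ cong (+ 5 *_) (cubeSum-closed k 0) ⟩
      + 5 * cubeSumPoly (+ 0) a b                   ≡⟨ cubeSumPoly-at-0 a b ⟩
      (a - + 1) * (b + a - + 1) * (L₄ - + 5 * L₃ + c)
        ≡⟨ cong (λ x → (a - + 1) * (x - + 1) * (L₄ - + 5 * L₃ + c)) (sym (pos-+ (F (suc N)) (F N))) ⟩
      (a - + 1) * (+ F (2 Nat.+ N) - + 1) * (L₄ - + 5 * L₃ + c)
        ≡⟨ cong₂ (λ x y → (a - + 1) * (+ F (2 Nat.+ N) - + 1) * (x - + 5 * y + c)) (sym +L₄) (sym +L₃) ⟩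
      (a - + 1) * (+ F (2 Nat.+ N) - + 1) * (+ L (4 Nat.+ (N Nat.+ N)) - + 5 * + L (3 Nat.+ N) + c) ∎
      where
      open ≡-Reasoning
      α = F N
      β = F (suc N)
      a = + α
      b = + β
      c = + 10 + + 3 * cassiniForm a b
      L₄ = + 3 * (a * a) + + 8 * (a * b) + + 7 * (b * b)
      L₃ = + 3 * a + + 4 * b
      twenty : ∀ x → + 20 * x ≡ + 5 * (+ 4 * x)
      twenty = solve-∀
      pos-k*xy : ∀ k x y → + (k Nat.* (x Nat.* y)) ≡ + k * (+ x * + y)
      pos-k*xy k x y = trans (pos-* k (x Nat.* y)) (cong (+ k *_) (pos-* x y))
      +L₄ : + L (4 Nat.+ (N Nat.+ N)) ≡ L₄
      +L₄ = begin
        + L (4 Nat.+ (N Nat.+ N))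
          ≡⟨ cong +_ (L-4+N+N N) ⟩
        + (3 Nat.* (α Nat.* α) Nat.+ 8 Nat.* (α Nat.* β) Nat.+ 7 Nat.* (β Nat.* β))
          ≡⟨ pos-+ (3 Nat.* (α Nat.* α) Nat.+ 8 Nat.* (α Nat.* β)) _ ⟩
        + (3 Nat.* (α Nat.* α) Nat.+ 8 Nat.* (α Nat.* β)) + + (7 Nat.* (β Nat.* β))
          ≡⟨ cong (_+ + (7 Nat.* (β Nat.* β))) (pos-+ (3 Nat.* (α Nat.* α)) _) ⟩
        + (3 Nat.* (α Nat.* α)) + + (8 Nat.* (α Nat.* β)) + + (7 Nat.* (β Nat.* β))
          ≡⟨ cong₂ _+_ (cong₂ _+_ (pos-k*xy 3 α α) (pos-k*xy 8 α β)) (pos-k*xy 7 β β) ⟩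
        L₄ ∎
      +L₃ : + L (3 Nat.+ N) ≡ L₃
      +L₃ = trans (cong +_ (L-3+N N)) (trans (pos-+ (3 Nat.* α) _) (cong₂ _+_ (pos-* 3 α) (pos-* 4 β)))

    A′-closedForm-even : ∀ k → + 20 * + A' fl (2 Nat.* k)
      ≡ closedForm (2 Nat.* k) (2 Nat.* k Nat.+ 2) (4 Nat.* k Nat.+ 4) (2 Nat.* k Nat.+ 3) (+ 13)
    A′-closedForm-even k = trans (A′-closedForm (2 Nat.* k)) (closedForm-cong {2 Nat.* k} (i₁ k) (i₂ k) (i₃ k)
      (cong (λ D → + 10 + + 3 * D) (cassiniForm-even (2 Nat.* k) (cassini-even k))))
      where
      i₁ : ∀ k → 2 Nat.+ 2 Nat.* k ≡ 2 Nat.* k Nat.+ 2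
      i₁ = NatSolver.solve-∀
      i₂ : ∀ k → 4 Nat.+ (2 Nat.* k Nat.+ 2 Nat.* k) ≡ 4 Nat.* k Nat.+ 4
      i₂ = NatSolver.solve-∀
      i₃ : ∀ k → 3 Nat.+ 2 Nat.* k ≡ 2 Nat.* k Nat.+ 3
      i₃ = NatSolver.solve-∀

    A′-closedForm-odd : ∀ k → 1 Nat.≤ k → + 20 * + A' fl (2 Nat.* k ∸ 1)
      ≡ closedForm (2 Nat.* k ∸ 1) (2 Nat.* k Nat.+ 1) (4 Nat.* k Nat.+ 2) (2 Nat.* k Nat.+ 2) (+ 7)
    A′-closedForm-odd k@(suc j) _ =
      -- 2 * suc j ∸ 1 reduces to j + suc (j + 0)
      subst (λ N → + 20 * + A' fl N ≡ closedForm N (2 Nat.* k Nat.+ 1) (4 Nat.* k Nat.+ 2) (2 Nat.* k Nat.+ 2) (+ 7))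
        (sym (NatP.+-suc j (j Nat.+ 0)))
        (trans (A′-closedForm (suc (2 Nat.* j))) (closedForm-cong {suc (2 Nat.* j)} (i₁ j) (i₂ j) (i₃ j)
          (cong (λ D → + 10 + + 3 * D) (cassiniForm-odd (suc (2 Nat.* j)) (cassini-odd j)))))
      where
      i₁ : ∀ j → 2 Nat.+ (1 Nat.+ 2 Nat.* j) ≡ 2 Nat.* (1 Nat.+ j) Nat.+ 1
      i₁ = NatSolver.solve-∀
      i₂ : ∀ j → 4 Nat.+ ((1 Nat.+ 2 Nat.* j) Nat.+ (1 Nat.+ 2 Nat.* j)) ≡ 4 Nat.* (1 Nat.+ j) Nat.+ 2
      i₂ = NatSolver.solve-∀
      i₃ : ∀ j → 3 Nat.+ (1 Nat.+ 2 Nat.* j) ≡ 2 Nat.* (1 Nat.+ j) Nat.+ 2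
      i₃ = NatSolver.solve-∀

open import Data.Integer using (ℤ; +_; _+_; _-_; _*_)
open import Data.Product using (_,_)

lemma4 : (fl : ℕ → ℕ) → (∀ n → IsFloorφ² n (fl n)) → (k : ℕ) → 1 ≤ k →
    ((+ 20) * (+ A' fl (2 Data.Nat.* k))
        ≡ ((+ F (2 Data.Nat.* k)) - + 1) * ((+ F (2 Data.Nat.* k Data.Nat.+ 2)) - + 1)
          * ((+ L (4 Data.Nat.* k Data.Nat.+ 4)) - (+ 5) * (+ L (2 Data.Nat.* k Data.Nat.+ 3)) + + 13))
    × ((+ 20) * (+ A' fl (2 Data.Nat.* k Data.Nat.∸ 1))
        ≡ ((+ F (2 Data.Nat.* k Data.Nat.∸ 1)) - + 1) * ((+ F (2 Data.Nat.* k Data.Nat.+ 1)) - + 1)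
          * ((+ L (4 Data.Nat.* k Data.Nat.+ 2)) - (+ 5) * (+ L (2 Data.Nat.* k Data.Nat.+ 2)) + + 7))
lemma4 fl hfl k 1≤k = A′-closedForm-even k , A′-closedForm-odd k 1≤k
  where open Floor.CubeSums fl hfl
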